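{- Let $D=(E,\mathcal F)$ be a delta-matroid and let $Z:=Z(D)$. Let $F$ be a feasible set of $D$, and let $e$ and $f$ be distinct elements of $E$ such that $e$ is $F$-orientable. Then $e$ is $F$-interlaced with $f$ if and only if $C(T(F),\omega_e)\cap \omega_f\neq \emptyset$.
   Context: A delta-matroid $(E,\mathcal F)$ is a finite set $E$ with a non-empty family $\mathcal F$ of subsets (feasible sets) such that for all $X,Y\in\mathcal F$ and $u\in X\triangle Y$ there is $v\in X\triangle Y$ with $X\triangle\{u,v\}\in\mathcal F$. A multimatroid $(U,\Omega,r)$ is a finite set $U$ partitioned into skew classes $\Omega$, with a non-negative integer function $r$ on subtransversals (sets meeting each skew class at most once) such that $r$ restricted to each transversal is a matroid rank function and $r(S\cup\{x\})+r(S\cup\{y\})-2r(S)\ge1$ for every subtransversal $S$ and distinct $x,y$ in a skew class disjoint from $S$; bases are maximal subtransversals $S$ with $r(S)=|S|$, circuits minimal subtransversals with $r(S)<|S|$; it is determined by its bases. $Z(D)$ is the multimatroid with $U=\{\dot e,\bar e: e\in E\}$, skew classes $\omega_e=\{\dot e,\bar e\}$, and bases the transversals $T(F)=\{\dot e:e\in F\}\cup\{\bar e:e\notin F\}$ for $F\in\mathcal F$. For a basis $B$ and skew class $\omega$, $B\cup\omega$ contains at most one circuit, the fundamental circuit $C(B,\omega)$. An element $e$ is $F$-orientable if $F\triangle\{e\}\notin\mathcal F$ (equivalently $C(T(F),\omega_e)$ exists). For distinct $e,f$ with $e$ $F$-orientable, $e$ is $F$-interlaced with $f$ if $F\triangle\{e,f\}\in\mathcal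 F$. -}

module Defs where

open import Data.Nat using (ℕ)
open import Data.Bool using (Bool; true; false; _xor_)
open import Data.Maybe using (Maybe; just; nothing)
open import Data.Fin using (Fin)
open import Data.Fin.Subset using (Subset; _∈_; _∉_; _∪_; ⁅_⁆)
open import Data.Vec using (lookup; zipWith)
open import Data.Product using (Σ; ∃; _×_; _,_)
open import Data.Sum using (_⊎_)
open import Relation.Nullary using (¬_)
open import Relation.Binary.PropositionalEquality using (_≡_; _≢_)

_△_ : ∀ {n} → Subset n → Subset n → Subset n
X △ Y = zipWith _xor_ X Y

record DeltaMatroid (n : ℕ) : Set₁ where
  field
    Feasible : Subset n → Set
    nonempty : ∃ λ X → Feasible X
    exchange : ∀ X Y → Feasible X → Feasible Y →
               ∀ u → u ∈ (X △ Y) →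
               ∃ λ v → v ∈ (X △ Y) × Feasible (X △ (⁅ u ⁆ ∪ ⁅ v ⁆))
open DeltaMatroid public

-- Ground set of Z(D): U = E × Bool, where (e , true) is ė ("dot e") and
-- (e , false) is ē ("bar e"); skew classes ω_e = {(e,true),(e,false)}.
-- A subtransversal (meets each skew class at most once) is a function
-- assigning to each e either nothing or the unique element of ω_e it contains.
SubTransversal : ℕ → Set
SubTransversal n = Fin n → Maybe Bool

_∈ₛ_ : ∀ {n} → Fin n × Bool → SubTransversal n → Set
(e , b) ∈ₛ S = S e ≡ just b

_⊆ₛ_ : ∀ {n} → SubTransversal n → SubTransversal n → Set
S ⊆ₛ S' = ∀ x → x ∈ₛ S → x ∈ₛ S'

_⊂ₛ_ : ∀ {n} → SubTransversal n → SubTransversal n → Set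
S ⊂ₛ S' = S ⊆ₛ S' × ∃ λ x → x ∈ₛ S' × ¬ (x ∈ₛ S)

T : ∀ {n} → Subset n → SubTransversal n
T F e = just (lookup F e)

module _ {n : ℕ} (D : DeltaMatroid n) where

  IsBasisZ : SubTransversal n → Set
  IsBasisZ B = ∃ λ F → Feasible D F × (∀ e → B e ≡ T F e)

  -- independent subtransversals of Z(D): r(S) = |S|, i.e. contained in a basis
  -- (r(S) = max over bases B of |S ∩ B|)
  IndependentZ : SubTransversal n → Set
  IndependentZ S = ∃ λ B → IsBasisZ B × S ⊆ₛ B

  IsCircuitZ : SubTransversal n → Set
  IsCircuitZ C = ¬ IndependentZ C × (∀ C' → C' ⊂ₛ C → IndependentZ C')

  -- C is a circuit contained in B ∪ ω_e, i.e. C is the fundamental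
  -- circuit C(B, ω_e) (which is unique when it exists)
  IsFundamentalCircuitZ : SubTransversal n → Fin n → SubTransversal n → Set
  IsFundamentalCircuitZ B e C =
    IsCircuitZ C × (∀ x b → (x , b) ∈ₛ C → (x , b) ∈ₛ B ⊎ x ≡ e)

  Orientable : Subset n → Fin n → Set
  Orientable F e = ¬ Feasible D (F △ ⁅ e ⁆)

  Interlaced : Subset n → Fin n → Fin n → Set
  Interlaced F e f = Feasible D (F △ (⁅ e ⁆ ∪ ⁅ f ⁆))

{-# OPTIONS --safe #-}
-- A subtransversal of Z(D) is independent iff it lies in T(G) for some feasible G.
-- As T(F) is independent, the circuit C contains the element of ω_e not in T(F),
-- and every feasible G that differs from F at e must also differ from F somewhere
-- else on the support of C.  So F △ {e, v} is infeasible whenever v ≠ e lies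
-- outside that support; in particular interlacing forces f into it.  Conversely,
-- if f is in the support, C minus its f-element lies in T(G) for a feasible G,
-- and e ∈ F △ G.  The exchange axiom gives v ∈ F △ G with F △ {e, v} feasible:
-- v = e contradicts orientability, and any v ∉ {e, f} lies outside the support
-- of C (where G agrees with F), so v = f.
module Submission where

open import Defs
open import Data.Bool using (Bool; true; false; not; _xor_; _∨_)
open import Data.Bool.Properties
  using (¬-not; not-¬; xor-same; xor-inverseˡ; xor-identityʳ; xor-comm; true-xor)
open import Data.Empty using (⊥-elim)
open import Data.Nat using (ℕ)
open import Data.Fin using (Fin; _≟_)
open import Data.Fin.Subset using (Subset; _∈_; _∪_; ⁅_⁆)
open import Data.Fin.Subset.Properties using (x∈⁅x⁆; x≢y⇒x∉⁅y⁆; ∪-idem)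
open import Data.Maybe using (just; nothing)
open import Data.Maybe.Properties using (just-injective)
open import Data.Product using (∃; _,_; _×_; proj₁; proj₂)
open import Data.Sum using (inj₁; inj₂)
open import Data.Vec using (lookup)
open import Data.Vec.Properties using (lookup-zipWith; []=⇒lookup; lookup⇒[]=)
open import Function.Base using (_∘_; case_of_)
open import Function.Bundles using (_⇔_; mk⇔)
open import Relation.Nullary using (¬_; yes; no; contradiction)
open import Relation.Binary.PropositionalEquality
  using (_≡_; _≢_; refl; sym; trans; cong; subst; module ≡-Reasoning)

private
  variable
    n : ℕ

lookup-⁅x⁆-self : (x : Fin n) → lookup ⁅ x ⁆ x ≡ true
lookup-⁅x⁆-self x = []=⇒lookup (x∈⁅x⁆ x)

lookup-⁅y⁆-≢ : {x y : Fin n} → x ≢ y → lookup ⁅ y ⁆ x ≡ false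
lookup-⁅y⁆-≢ {x = x} {y} x≢y with lookup ⁅ y ⁆ x in eq
... | false = refl
... | true  = contradiction (lookup⇒[]= x ⁅ y ⁆ eq) (x≢y⇒x∉⁅y⁆ x≢y)

lookup-△ : (X Y : Subset n) (x : Fin n) → lookup (X △ Y) x ≡ lookup X x xor lookup Y x
lookup-△ X Y x = lookup-zipWith _xor_ x X Y

lookup-△-⁅x⁆∪⁅y⁆-head : (X : Subset n) (x y : Fin n) →
                         lookup (X △ (⁅ x ⁆ ∪ ⁅ y ⁆)) x ≡ not (lookup X x)
lookup-△-⁅x⁆∪⁅y⁆-head X x y = begin
  lookup (X △ (⁅ x ⁆ ∪ ⁅ y ⁆)) x             ≡⟨ lookup-△ X (⁅ x ⁆ ∪ ⁅ y ⁆) x ⟩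
  lookup X x xor lookup (⁅ x ⁆ ∪ ⁅ y ⁆) x    ≡⟨ cong (lookup X x xor_) (lookup-zipWith _∨_ x ⁅ x ⁆ ⁅ y ⁆) ⟩
  lookup X x xor (lookup ⁅ x ⁆ x ∨ lookup ⁅ y ⁆ x)
                                             ≡⟨ cong (λ b → lookup X x xor (b ∨ lookup ⁅ y ⁆ x)) (lookup-⁅x⁆-self x) ⟩
  lookup X x xor true                        ≡⟨ xor-comm (lookup X x) true ⟩
  true xor lookup X x                        ≡⟨ true-xor (lookup X x) ⟩
  not (lookup X x)                           ∎
  where open ≡-Reasoning

lookup-△-⁅x⁆∪⁅y⁆-outside : (X : Subset n) {x y z : Fin n} → z ≢ x → z ≢ y →
                            lookup (X △ (⁅ x ⁆ ∪ ⁅ y ⁆)) z ≡ lookup X z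
lookup-△-⁅x⁆∪⁅y⁆-outside X {x} {y} {z} z≢x z≢y = begin
  lookup (X △ (⁅ x ⁆ ∪ ⁅ y ⁆)) z             ≡⟨ lookup-△ X (⁅ x ⁆ ∪ ⁅ y ⁆) z ⟩
  lookup X z xor lookup (⁅ x ⁆ ∪ ⁅ y ⁆) z    ≡⟨ cong (lookup X z xor_) (lookup-zipWith _∨_ z ⁅ x ⁆ ⁅ y ⁆) ⟩
  lookup X z xor (lookup ⁅ x ⁆ z ∨ lookup ⁅ y ⁆ z)
    ≡⟨ cong (λ b → lookup X z xor (b ∨ lookup ⁅ y ⁆ z)) (lookup-⁅y⁆-≢ z≢x) ⟩
  lookup X z xor lookup ⁅ y ⁆ z              ≡⟨ cong (lookup X z xor_) (lookup-⁅y⁆-≢ z≢y) ⟩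
  lookup X z xor false                       ≡⟨ xor-identityʳ (lookup X z) ⟩
  lookup X z                                 ∎
  where open ≡-Reasoning

x∈X△Y⇒lookup≢ : (X Y : Subset n) {x : Fin n} → x ∈ X △ Y → lookup X x ≢ lookup Y x
x∈X△Y⇒lookup≢ X Y {x} x∈X△Y X≡Y = contradiction true≡false λ ()
  where
  open ≡-Reasoning
  true≡false : true ≡ false
  true≡false = begin
    true                          ≡⟨ sym ([]=⇒lookup x∈X△Y) ⟩
    lookup (X △ Y) x              ≡⟨ lookup-△ X Y x ⟩
    lookup X x xor lookup Y x     ≡⟨ cong (_xor lookup Y x) X≡Y ⟩
    lookup Y x xor lookup Y x     ≡⟨ xor-same (lookup Y x) ⟩
    false                         ∎

lookup≢⇒x∈X△Y : (X Y : Subset n) {x : Fin n} → lookup X x ≢ lookup Y x → x ∈ X △ Y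
lookup≢⇒x∈X△Y X Y {x} X≢Y = lookup⇒[]= x (X △ Y) (begin
  lookup (X △ Y) x                 ≡⟨ lookup-△ X Y x ⟩
  lookup X x xor lookup Y x        ≡⟨ cong (_xor lookup Y x) (¬-not X≢Y) ⟩
  not (lookup Y x) xor lookup Y x  ≡⟨ xor-inverseˡ (lookup Y x) ⟩
  true                             ∎)
  where open ≡-Reasoning

_-ₛ_ : SubTransversal n → Fin n → SubTransversal n
(S -ₛ x) y with y ≟ x
... | yes _ = nothing
... | no  _ = S y

S-ₛx-≢ : (S : SubTransversal n) {x y : Fin n} → y ≢ x → (S -ₛ x) y ≡ S y
S-ₛx-≢ S {x} {y} y≢x with y ≟ x
... | yes y≡x = contradiction y≡x y≢x
... | no  _   = refl

x∉ₛS-ₛx : (S : SubTransversal n) (x : Fin n) {b : Bool} → ¬ (x , b) ∈ₛ (S -ₛ x)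
x∉ₛS-ₛx S x x∈ with x ≟ x | x∈
... | yes _   | ()
... | no  x≢x | _ = x≢x refl

S-ₛx⊆ₛS : (S : SubTransversal n) (x : Fin n) → (S -ₛ x) ⊆ₛ S
S-ₛx⊆ₛS S x (y , b) y∈ with y ≟ x | y∈
... | yes _ | ()
... | no  _ | y∈S = y∈S

x∈ₛS⇒S-ₛx⊂ₛS : (S : SubTransversal n) {x : Fin n} {b : Bool} → (x , b) ∈ₛ S → (S -ₛ x) ⊂ₛ S
x∈ₛS⇒S-ₛx⊂ₛS S {x} x∈S = S-ₛx⊆ₛS S x , (x , _) , x∈S , x∉ₛS-ₛx S x

module _ (D : DeltaMatroid n) where

  feasible-⊆ₛT⇒independent : {G : Subset n} {S : SubTransversal n} →
                              Feasible D G → S ⊆ₛ T G → IndependentZ D S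
  feasible-⊆ₛT⇒independent {G} G-feasible S⊆T = T G , (G , G-feasible , λ _ → refl) , S⊆T

  independent⇒⊆ₛT : {S : SubTransversal n} → IndependentZ D S →
                     ∃ λ G → Feasible D G × S ⊆ₛ T G
  independent⇒⊆ₛT (B , (G , G-feasible , B≡T) , S⊆B) =
    G , G-feasible , λ x x∈S → trans (sym (B≡T _)) (S⊆B x x∈S)

  circuit⇒⊈ₛT : {C : SubTransversal n} {G : Subset n} →
                IsCircuitZ D C → Feasible D G → ¬ C ⊆ₛ T G
  circuit⇒⊈ₛT (dependent , _) G-feasible C⊆T =
    dependent (feasible-⊆ₛT⇒independent G-feasible C⊆T)

  circuit-ₛ⇒⊆ₛT : {C : SubTransversal n} {x : Fin n} {b : Bool} →
                  IsCircuitZ D C → (x , b) ∈ₛ C →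
                  ∃ λ G → Feasible D G × (C -ₛ x) ⊆ₛ T G
  circuit-ₛ⇒⊆ₛT {C} (_ , minimal) x∈C = independent⇒⊆ₛT (minimal _ (x∈ₛS⇒S-ₛx⊂ₛS C x∈C))

  module FundamentalCircuit {F : Subset n} {e : Fin n} {C : SubTransversal n}
    (F-feasible : Feasible D F) (fundamental : IsFundamentalCircuitZ D (T F) e C) where

    circuit : IsCircuitZ D C
    circuit = proj₁ fundamental

    lookup-F-support : {x : Fin n} {b : Bool} → x ≢ e → (x , b) ∈ₛ C → lookup F x ≡ b
    lookup-F-support {x} {b} x≢e x∈C with proj₂ fundamental x b x∈C
    ... | inj₁ x∈T = just-injective x∈T
    ... | inj₂ x≡e = contradiction x≡e x≢e

    ⊆ₛT-if-agrees : {G : Subset n} →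
                    (∀ {b} → (e , b) ∈ₛ C → lookup G e ≡ b) →
                    (∀ {x b} → x ≢ e → (x , b) ∈ₛ C → lookup G x ≡ lookup F x) →
                    C ⊆ₛ T G
    ⊆ₛT-if-agrees agrees-at-e agrees-off-e (x , b) x∈C with x ≟ e
    ... | yes refl = cong just (agrees-at-e x∈C)
    ... | no  x≢e  = cong just (trans (agrees-off-e x≢e x∈C) (lookup-F-support x≢e x∈C))

    F-disagrees-at-e : ¬ (∀ {b} → (e , b) ∈ₛ C → lookup F e ≡ b)
    F-disagrees-at-e agrees-at-e =
      circuit⇒⊈ₛT circuit F-feasible (⊆ₛT-if-agrees {F} agrees-at-e λ _ _ → refl)

    e-flipped∈ₛC : (e , not (lookup F e)) ∈ₛ C
    e-flipped∈ₛC with C e in Ce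
    ... | nothing = ⊥-elim (F-disagrees-at-e λ e∈C → case trans (sym Ce) e∈C of λ ())
    ... | just b  = cong just (¬-not λ b≡Fe →
                      F-disagrees-at-e λ e∈C → trans (sym b≡Fe) (just-injective (trans (sym Ce) e∈C)))

    flip-pair-outside-support-infeasible : {v : Fin n} → v ≢ e → (∀ {b} → ¬ (v , b) ∈ₛ C) →
                                           ¬ Feasible D (F △ (⁅ e ⁆ ∪ ⁅ v ⁆))
    flip-pair-outside-support-infeasible {v} v≢e v∉C feasible =
      circuit⇒⊈ₛT circuit feasible (⊆ₛT-if-agrees {F △ (⁅ e ⁆ ∪ ⁅ v ⁆)} agrees-at-e agrees-off-e)
      where
      agrees-at-e : ∀ {b} → (e , b) ∈ₛ C → lookup (F △ (⁅ e ⁆ ∪ ⁅ v ⁆)) e ≡ b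
      agrees-at-e e∈C =
        trans (lookup-△-⁅x⁆∪⁅y⁆-head F e v) (just-injective (trans (sym e-flipped∈ₛC) e∈C))
      agrees-off-e : ∀ {x b} → x ≢ e → (x , b) ∈ₛ C → lookup (F △ (⁅ e ⁆ ∪ ⁅ v ⁆)) x ≡ lookup F x
      agrees-off-e x≢e x∈C = lookup-△-⁅x⁆∪⁅y⁆-outside F x≢e λ { refl → v∉C x∈C }

    C-ₛ⊆ₛT⇒lookup : {f : Fin n} {G : Subset n} → (C -ₛ f) ⊆ₛ T G →
                  ∀ {x b} → x ≢ f → (x , b) ∈ₛ C → lookup G x ≡ b
    C-ₛ⊆ₛT⇒lookup C-f⊆T x≢f x∈C = just-injective (C-f⊆T _ (trans (S-ₛx-≢ C x≢f) x∈C))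

    C-ₛ⊆ₛT⇒e∈F△G : {f : Fin n} {G : Subset n} → e ≢ f → (C -ₛ f) ⊆ₛ T G → e ∈ F △ G
    C-ₛ⊆ₛT⇒e∈F△G {f} {G} e≢f C-f⊆T = lookup≢⇒x∈X△Y F G λ Fe≡Ge →
      not-¬ refl (trans Fe≡Ge (C-ₛ⊆ₛT⇒lookup {f} {G} C-f⊆T e≢f e-flipped∈ₛC))

    interlaced⇒∈ₛC : {f : Fin n} → e ≢ f → Interlaced D F e f → ∃ λ b → C f ≡ just b
    interlaced⇒∈ₛC {f} e≢f interlaced with C f in Cf
    ... | just b  = b , refl
    ... | nothing = ⊥-elim (flip-pair-outside-support-infeasible (e≢f ∘ sym)
                              (λ f∈C → case trans (sym Cf) f∈C of λ ()) interlaced)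

    ∈ₛC⇒interlaced : {f : Fin n} → e ≢ f → Orientable D F e →
                     (∃ λ b → C f ≡ just b) → Interlaced D F e f
    ∈ₛC⇒interlaced {f} e≢f orientable (_ , f∈C)
      with G , G-feasible , C-f⊆T ← circuit-ₛ⇒⊆ₛT circuit f∈C
      with v , v∈F△G , F△ev-feasible ← exchange D F G F-feasible G-feasible e (C-ₛ⊆ₛT⇒e∈F△G e≢f C-f⊆T)
      with v ≟ e | v ≟ f
    ... | yes refl | _ =
      contradiction (subst (λ X → Feasible D (F △ X)) (∪-idem ⁅ e ⁆) F△ev-feasible) orientable
    ... | no _ | yes refl = F△ev-feasible
    ... | no v≢e | no v≢f =
      contradiction F△ev-feasible (flip-pair-outside-support-infeasible v≢e v∉C)
      where
      v∉C : ∀ {b} → ¬ (v , b) ∈ₛ C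
      v∉C v∈C = x∈X△Y⇒lookup≢ F G v∈F△G
        (trans (lookup-F-support v≢e v∈C) (sym (C-ₛ⊆ₛT⇒lookup {f} {G} C-f⊆T v≢f v∈C)))

lemma5p2 : ∀ {n} (D : DeltaMatroid n) (F : Subset n) (e f : Fin n) →
    Feasible D F → e ≢ f → Orientable D F e →
    ∀ (C : SubTransversal n) → IsFundamentalCircuitZ D (T F) e C →
    (Interlaced D F e f ⇔ (∃ λ (b : Bool) → C f ≡ just b))
lemma5p2 D F e f F-feasible e≢f orientable C fundamental =
  mk⇔ (interlaced⇒∈ₛC e≢f) (∈ₛC⇒interlaced e≢f orientable)
  where open FundamentalCircuit D F-feasible fundamental
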